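{- Let $s\ge 2$ and let $f_1(x),\ldots,f_s(x)\in\mathbb{Z}[x]$ be nonzero coprime polynomials. For $n\in\mathbb{Z}$ let $d_n=\gcd(f_1(n),\ldots,f_s(n))$, $\mathcal{D}^\ast=\{d_n\mid n\in\mathbb{Z}\}$, and let $d^\ast$ and $m^\ast$ be the gcd and the lcm of all elements of $\mathcal{D}^\ast$. Then $d^\ast\in\mathcal{D}^\ast$ and $m^\ast\in\mathcal{D}^\ast$. Furthermore $d^\ast=\min(\mathcal{D}^\ast)$ and it is the greatest integer dividing $f_1(n),\ldots,f_s(n)$ for every $n\in\mathbb{Z}$; similarly $m^\ast=\max(\mathcal{D}^\ast)$.
   Context: Polynomials are coprime if their gcd in $\mathbb{Q}[x]$ is $1$ (equivalently, no common complex root). -}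

module Defs where

open import Data.Nat as ℕ using (ℕ; zero; suc)
open import Data.Nat.GCD using (gcd)
open import Data.Nat.Divisibility as ℕD using ()
open import Data.Integer as ℤ using (ℤ; ∣_∣)
open import Data.Integer.Divisibility as ℤD using ()
open import Data.Rational as ℚ using (ℚ; 0ℚ; 1ℚ)
open import Data.List using (List; []; _∷_; foldr; map)
open import Data.Fin using (Fin)
open import Data.Vec.Functional using (Vector; foldr)
open import Data.Product using (Σ; ∃; _×_)
open import Relation.Binary.PropositionalEquality using (_≡_; _≢_)

-- A polynomial with coefficients in a type A is a list of coefficients,
-- constant term first:  a₀ ∷ a₁ ∷ … represents a₀ + a₁ x + …
-- (trailing zeros allowed; polynomials are compared coefficientwise).

ℤPoly : Set
ℤPoly = List ℤ

ℚPoly : Set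
ℚPoly = List ℚ

evalℤ : ℤPoly → ℤ → ℤ
evalℤ []       x = ℤ.0ℤ
evalℤ (a ∷ p)  x = a ℤ.+ x ℤ.* evalℤ p x

coeff : ℚPoly → ℕ → ℚ
coeff []      i       = 0ℚ
coeff (a ∷ p) zero    = a
coeff (a ∷ p) (suc i) = coeff p i

_≈ₚ_ : ℚPoly → ℚPoly → Set
p ≈ₚ q = ∀ i → coeff p i ≡ coeff q i

_+ₚ_ : ℚPoly → ℚPoly → ℚPoly
[]      +ₚ q       = q
(a ∷ p) +ₚ []      = a ∷ p
(a ∷ p) +ₚ (b ∷ q) = (a ℚ.+ b) ∷ (p +ₚ q)

scaleₚ : ℚ → ℚPoly → ℚPoly
scaleₚ c = map (c ℚ.*_)

_*ₚ_ : ℚPoly → ℚPoly → ℚPoly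
[]      *ₚ q = []
(a ∷ p) *ₚ q = scaleₚ a q +ₚ (0ℚ ∷ (p *ₚ q))

toℚPoly : ℤPoly → ℚPoly
toℚPoly = map (λ a → a ℚ./ 1)

_∣ₚ_ : ℚPoly → ℚPoly → Set
g ∣ₚ f = Σ ℚPoly (λ h → (g *ₚ h) ≈ₚ f)

IsUnitₚ : ℚPoly → Set
IsUnitₚ g = Σ ℚ (λ c → c ≢ 0ℚ × g ≈ₚ (c ∷ []))

IsZeroₚ : ℚPoly → Set
IsZeroₚ p = p ≈ₚ []

Coprime : {s : ℕ} → Vector ℤPoly s → Set
Coprime {s} f = ∀ (g : ℚPoly) → (∀ (i : Fin s) → g ∣ₚ toℚPoly (f i)) → IsUnitₚ g

dₙ : {s : ℕ} → Vector ℤPoly s → ℤ → ℕ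
dₙ f n = Data.Vec.Functional.foldr (λ a b → gcd ∣ a ∣ b) 0 (λ i → evalℤ (f i) n)

_∈𝒟*_ : {s : ℕ} → ℕ → Vector ℤPoly s → Set
d ∈𝒟* f = ∃ (λ (n : ℤ) → d ≡ dₙ f n)

IsGCDof𝒟* : {s : ℕ} → Vector ℤPoly s → ℕ → Set
IsGCDof𝒟* f d =
  (∀ (n : ℤ) → d ℕD.∣ dₙ f n) ×
  (∀ (c : ℕ) → (∀ (n : ℤ) → c ℕD.∣ dₙ f n) → c ℕD.∣ d)

IsLCMof𝒟* : {s : ℕ} → Vector ℤPoly s → ℕ → Set
IsLCMof𝒟* f m =
  (∀ (n : ℤ) → dₙ f n ℕD.∣ m) ×
  (∀ (c : ℕ) → (∀ (n : ℤ) → dₙ f n ℕD.∣ c) → m ℕD.∣ c)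

-- Euclid's algorithm with pseudo-division never leaves an ideal of ℤ[x], so run on the fᵢ inside
-- the ideal of polynomials whose value at every n is divisible by dₙ it produces a gcd G of the fᵢ
-- there; coprimality makes G a nonzero constant R, hence dₙ ∣ R for all n. For c ∣ M, whether
-- c ∣ dₙ depends only on n mod M. For a prime power pᵉ the parts gcd (dₙ, pᵉ) are totally ordered by
-- divisibility, so they can be minimised (or maximised) one prime at a time, and the Chinese
-- remainder theorem combines these choices into a single n with dₙ = d* (or dₙ = m*).

module Submission where

open import Defs
open import Data.Nat as ℕ using (ℕ; _≤_)
open import Data.Integer as ℤ using (ℤ; +_)
open import Data.Integer.Divisibility as ℤD using ()
open import Data.Fin using (Fin)
open import Data.Vec.Functional using (Vector)
open import Data.Product using (∃; _×_)
open import Relation.Nullary using (¬_)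

open import Data.Nat using (zero; suc; z≤n; s≤s; z<s; _<_; _∸_; _*_; _^_; NonZero)
import Data.Nat.Properties as ℕP
open import Data.Nat.Divisibility
  using (_∣_; divides; ∣-refl; ∣-trans; 1∣_; _∣0; _∣?_; ∣1⇒≡1; 0∣⇒≡0; ∣⇒≤; m∣m*n; n∣m*n; *-monoˡ-∣; *-cancelʳ-∣)
open import Data.Nat.GCD using (gcd; gcd[m,n]∣m; gcd[m,n]∣n; gcd-greatest; c*gcd[m,n]≡gcd[cm,cn]; module Bézout)
open import Data.Nat.LCM using (lcm; lcm-least; gcd*lcm)
import Data.Nat.Coprimality as ℕC
open import Data.Nat.Primality using (Prime; prime⇒irreducible; prime⇒nonTrivial; prime⇒nonZero)
open import Data.Nat.Primality.Factorisation using (factorise)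
open import Data.Nat.ListAction using (product)
open import Data.Nat.Induction using (<-rec)
open import Induction.WellFounded using (WfRec)
open import Data.Integer using (-[1+_]; 0ℤ; ∣_∣)
import Data.Integer.Properties as ℤP
import Data.Integer.DivMod as ℤDM
import Data.Integer.Divisibility.Signed as ℤS
import Data.Integer.Solver as ℤSolver
open import Data.Rational as ℚ using (ℚ; 0ℚ; 1ℚ)
import Data.Rational.Properties as ℚP
import Data.Rational.Unnormalised as ℚᵘ
import Data.Rational.Unnormalised.Properties as ℚᵘP
import Data.Rational.Solver as ℚSolver
import Data.Fin as Fin
open import Data.Vec.Functional using (foldr; head; tail)
open import Data.List using ([]; _∷_; map; length)
open import Data.List.Relation.Unary.All using (_∷_)
open import Data.Product using (Σ; _,_)
open import Data.Sum using (_⊎_; inj₁; inj₂)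
import Data.Sum as Sum
open import Data.Empty using (⊥-elim)
open import Function using (flip)
open import Relation.Nullary using (yes; no)
open import Relation.Binary.PropositionalEquality

-- ℚ[x]

ι : ℤ → ℚ
ι a = a ℚ./ 1

private
  ι≃ : ∀ a → ℚ.toℚᵘ (ι a) ℚᵘ.≃ ℚᵘ.mkℚᵘ a 0
  ι≃ a = ℚP.toℚᵘ-fromℚᵘ (ℚᵘ.mkℚᵘ a 0)

ι-+ : ∀ a b → ι (a ℤ.+ b) ≡ ι a ℚ.+ ι b
ι-+ a b = ℚP.toℚᵘ-injective (ℚᵘP.≃-trans (ι≃ (a ℤ.+ b)) (ℚᵘP.≃-trans (ℚᵘ.*≡* (cross-multiplied a b))
  (ℚᵘP.≃-sym (ℚᵘP.≃-trans (ℚP.toℚᵘ-homo-+ (ι a) (ι b)) (ℚᵘP.+-cong (ι≃ a) (ι≃ b))))))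
  where
  open ℤSolver.+-*-Solver
  cross-multiplied : ∀ a b → (a ℤ.+ b) ℤ.* + 1 ≡ (a ℤ.* + 1 ℤ.+ b ℤ.* + 1) ℤ.* + 1
  cross-multiplied = solve 2 (λ a b → (a :+ b) :* con (+ 1) := (a :* con (+ 1) :+ b :* con (+ 1)) :* con (+ 1)) refl

ι-* : ∀ a b → ι (a ℤ.* b) ≡ ι a ℚ.* ι b
ι-* a b = ℚP.toℚᵘ-injective (ℚᵘP.≃-trans (ι≃ (a ℤ.* b)) (ℚᵘP.≃-sym
  (ℚᵘP.≃-trans (ℚP.toℚᵘ-homo-* (ι a) (ι b)) (ℚᵘP.*-cong (ι≃ a) (ι≃ b)))))

ι-injective : ∀ {a b} → ι a ≡ ι b → a ≡ b
ι-injective {a} {b} eq with ℚP.fromℚᵘ-injective {ℚᵘ.mkℚᵘ a 0} {ℚᵘ.mkℚᵘ b 0} eq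
... | ℚᵘ.*≡* a*1≡b*1 = trans (sym (ℤP.*-identityʳ a)) (trans a*1≡b*1 (ℤP.*-identityʳ b))

shiftₚ : ℕ → ℚPoly → ℚPoly
shiftₚ zero    h = h
shiftₚ (suc j) h = 0ℚ ∷ shiftₚ j h

coeff-+ₚ : ∀ p q i → coeff (p +ₚ q) i ≡ coeff p i ℚ.+ coeff q i
coeff-+ₚ []      q       i       = sym (ℚP.+-identityˡ _)
coeff-+ₚ (a ∷ p) []      i       = sym (ℚP.+-identityʳ _)
coeff-+ₚ (a ∷ p) (b ∷ q) zero    = refl
coeff-+ₚ (a ∷ p) (b ∷ q) (suc i) = coeff-+ₚ p q i

coeff-scaleₚ : ∀ c p i → coeff (scaleₚ c p) i ≡ c ℚ.* coeff p i
coeff-scaleₚ c []      i       = sym (ℚP.*-zeroʳ c)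
coeff-scaleₚ c (a ∷ p) zero    = refl
coeff-scaleₚ c (a ∷ p) (suc i) = coeff-scaleₚ c p i

shiftₚ-cong : ∀ j {h h′} → h ≈ₚ h′ → shiftₚ j h ≈ₚ shiftₚ j h′
shiftₚ-cong zero    h≈h′ i       = h≈h′ i
shiftₚ-cong (suc j) h≈h′ zero    = refl
shiftₚ-cong (suc j) h≈h′ (suc i) = shiftₚ-cong j h≈h′ i

coeff-*ₚ-zero : ∀ a g h → coeff ((a ∷ g) *ₚ h) zero ≡ a ℚ.* coeff h zero
coeff-*ₚ-zero a g h = trans (coeff-+ₚ (scaleₚ a h) (0ℚ ∷ (g *ₚ h)) zero)
  (trans (cong (ℚ._+ 0ℚ) (coeff-scaleₚ a h zero)) (ℚP.+-identityʳ _))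

coeff-*ₚ-suc : ∀ a g h i →
  coeff ((a ∷ g) *ₚ h) (suc i) ≡ a ℚ.* coeff h (suc i) ℚ.+ coeff (g *ₚ h) i
coeff-*ₚ-suc a g h i = trans (coeff-+ₚ (scaleₚ a h) (0ℚ ∷ (g *ₚ h)) (suc i))
  (cong (ℚ._+ coeff (g *ₚ h) i) (coeff-scaleₚ a h (suc i)))

*ₚ-zeroʳ : ∀ g → (g *ₚ []) ≈ₚ []
*ₚ-zeroʳ []      i       = refl
*ₚ-zeroʳ (a ∷ g) zero    = trans (coeff-*ₚ-zero a g []) (ℚP.*-zeroʳ a)
*ₚ-zeroʳ (a ∷ g) (suc i) = trans (coeff-*ₚ-suc a g [] i)
  (trans (cong₂ ℚ._+_ (ℚP.*-zeroʳ a) (*ₚ-zeroʳ g i)) (ℚP.+-identityʳ 0ℚ))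

*ₚ-identityʳ : ∀ g → (g *ₚ (1ℚ ∷ [])) ≈ₚ g
*ₚ-identityʳ []      i       = refl
*ₚ-identityʳ (a ∷ g) zero    = trans (coeff-*ₚ-zero a g (1ℚ ∷ [])) (ℚP.*-identityʳ a)
*ₚ-identityʳ (a ∷ g) (suc i) = trans (coeff-*ₚ-suc a g (1ℚ ∷ []) i)
  (trans (cong₂ ℚ._+_ (ℚP.*-zeroʳ a) (*ₚ-identityʳ g i)) (ℚP.+-identityˡ _))

*ₚ-distribˡ-+ₚ : ∀ g h₁ h₂ i →
  coeff (g *ₚ (h₁ +ₚ h₂)) i ≡ coeff (g *ₚ h₁) i ℚ.+ coeff (g *ₚ h₂) i
*ₚ-distribˡ-+ₚ []      h₁ h₂ i       = sym (ℚP.+-identityˡ 0ℚ)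
*ₚ-distribˡ-+ₚ (a ∷ g) h₁ h₂ zero    =
  trans (coeff-*ₚ-zero a g (h₁ +ₚ h₂)) (trans (cong (a ℚ.*_) (coeff-+ₚ h₁ h₂ zero))
    (trans (ℚP.*-distribˡ-+ a _ _) (sym (cong₂ ℚ._+_ (coeff-*ₚ-zero a g h₁) (coeff-*ₚ-zero a g h₂)))))
*ₚ-distribˡ-+ₚ (a ∷ g) h₁ h₂ (suc i) =
  trans (coeff-*ₚ-suc a g (h₁ +ₚ h₂) i)
    (trans (cong₂ (λ x y → a ℚ.* x ℚ.+ y) (coeff-+ₚ h₁ h₂ (suc i)) (*ₚ-distribˡ-+ₚ g h₁ h₂ i))
      (trans (interchange a _ _ _ _) (sym (cong₂ ℚ._+_ (coeff-*ₚ-suc a g h₁ i) (coeff-*ₚ-suc a g h₂ i)))))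
  where
  open ℚSolver.+-*-Solver
  interchange : ∀ a x y u v → a ℚ.* (x ℚ.+ y) ℚ.+ (u ℚ.+ v) ≡ (a ℚ.* x ℚ.+ u) ℚ.+ (a ℚ.* y ℚ.+ v)
  interchange = solve 5 (λ a x y u v → a :* (x :+ y) :+ (u :+ v) := (a :* x :+ u) :+ (a :* y :+ v)) refl

*ₚ-scaleₚ : ∀ g c h i → coeff (g *ₚ scaleₚ c h) i ≡ c ℚ.* coeff (g *ₚ h) i
*ₚ-scaleₚ []      c h i       = sym (ℚP.*-zeroʳ c)
*ₚ-scaleₚ (a ∷ g) c h zero    =
  trans (coeff-*ₚ-zero a g (scaleₚ c h)) (trans (cong (a ℚ.*_) (coeff-scaleₚ c h zero))
    (trans (swap a c _) (sym (cong (c ℚ.*_) (coeff-*ₚ-zero a g h)))))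
  where
  open ℚSolver.+-*-Solver
  swap : ∀ a c x → a ℚ.* (c ℚ.* x) ≡ c ℚ.* (a ℚ.* x)
  swap = solve 3 (λ a c x → a :* (c :* x) := c :* (a :* x)) refl
*ₚ-scaleₚ (a ∷ g) c h (suc i) =
  trans (coeff-*ₚ-suc a g (scaleₚ c h) i)
    (trans (cong₂ (λ x y → a ℚ.* x ℚ.+ y) (coeff-scaleₚ c h (suc i)) (*ₚ-scaleₚ g c h i))
      (trans (factor a c _ _) (sym (cong (c ℚ.*_) (coeff-*ₚ-suc a g h i)))))
  where
  open ℚSolver.+-*-Solver
  factor : ∀ a c x u → a ℚ.* (c ℚ.* x) ℚ.+ c ℚ.* u ≡ c ℚ.* (a ℚ.* x ℚ.+ u)
  factor = solve 4 (λ a c x u → a :* (c :* x) :+ c :* u := c :* (a :* x :+ u)) refl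

*ₚ-x* : ∀ g h → (g *ₚ (0ℚ ∷ h)) ≈ₚ (0ℚ ∷ (g *ₚ h))
*ₚ-x* []      h zero          = refl
*ₚ-x* []      h (suc i)       = refl
*ₚ-x* (a ∷ g) h zero          = trans (coeff-*ₚ-zero a g (0ℚ ∷ h)) (ℚP.*-zeroʳ a)
*ₚ-x* (a ∷ g) h (suc zero)    = trans (coeff-*ₚ-suc a g (0ℚ ∷ h) zero)
  (trans (cong (a ℚ.* coeff h zero ℚ.+_) (*ₚ-x* g h zero))
    (trans (ℚP.+-identityʳ _) (sym (coeff-*ₚ-zero a g h))))
*ₚ-x* (a ∷ g) h (suc (suc i)) = trans (coeff-*ₚ-suc a g (0ℚ ∷ h) (suc i))
  (trans (cong (a ℚ.* coeff h (suc i) ℚ.+_) (*ₚ-x* g h (suc i))) (sym (coeff-*ₚ-suc a g h i)))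

*ₚ-shiftₚ : ∀ g j h → (g *ₚ shiftₚ j h) ≈ₚ shiftₚ j (g *ₚ h)
*ₚ-shiftₚ g zero    h i       = refl
*ₚ-shiftₚ g (suc j) h zero    = *ₚ-x* g (shiftₚ j h) zero
*ₚ-shiftₚ g (suc j) h (suc i) = trans (*ₚ-x* g (shiftₚ j h) (suc i)) (*ₚ-shiftₚ g j h i)

∣ₚ-respʳ : ∀ g f f′ → f ≈ₚ f′ → g ∣ₚ f → g ∣ₚ f′
∣ₚ-respʳ g f f′ f≈f′ (h , gh≈f) = h , λ i → trans (gh≈f i) (f≈f′ i)

∣ₚ-refl : ∀ g → g ∣ₚ g
∣ₚ-refl g = 1ℚ ∷ [] , *ₚ-identityʳ g

∣ₚ-[] : ∀ g → g ∣ₚ []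
∣ₚ-[] g = [] , *ₚ-zeroʳ g

∣ₚ-+ₚ : ∀ g f₁ f₂ → g ∣ₚ f₁ → g ∣ₚ f₂ → g ∣ₚ (f₁ +ₚ f₂)
∣ₚ-+ₚ g f₁ f₂ (h₁ , e₁) (h₂ , e₂) = h₁ +ₚ h₂ , λ i →
  trans (*ₚ-distribˡ-+ₚ g h₁ h₂ i) (trans (cong₂ ℚ._+_ (e₁ i) (e₂ i)) (sym (coeff-+ₚ f₁ f₂ i)))

∣ₚ-scaleₚ : ∀ g f c → g ∣ₚ f → g ∣ₚ scaleₚ c f
∣ₚ-scaleₚ g f c (h , e) = scaleₚ c h , λ i →
  trans (*ₚ-scaleₚ g c h i) (trans (cong (c ℚ.*_) (e i)) (sym (coeff-scaleₚ c f i)))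

∣ₚ-shiftₚ : ∀ g f j → g ∣ₚ f → g ∣ₚ shiftₚ j f
∣ₚ-shiftₚ g f j (h , e) = shiftₚ j h , λ i →
  trans (*ₚ-shiftₚ g j h i) (shiftₚ-cong j e i)

-- ℤ[x] and trimming

coeffℤ : ℤPoly → ℕ → ℤ
coeffℤ []      i       = 0ℤ
coeffℤ (a ∷ p) zero    = a
coeffℤ (a ∷ p) (suc i) = coeffℤ p i

_+ℤₚ_ : ℤPoly → ℤPoly → ℤPoly
[]      +ℤₚ q       = q
(a ∷ p) +ℤₚ []      = a ∷ p
(a ∷ p) +ℤₚ (b ∷ q) = (a ℤ.+ b) ∷ (p +ℤₚ q)

scaleℤₚ : ℤ → ℤPoly → ℤPoly
scaleℤₚ c = map (c ℤ.*_)

shiftℤₚ : ℕ → ℤPoly → ℤPoly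
shiftℤₚ zero    q = q
shiftℤₚ (suc j) q = 0ℤ ∷ shiftℤₚ j q

coeffℤ-+ℤₚ : ∀ p q i → coeffℤ (p +ℤₚ q) i ≡ coeffℤ p i ℤ.+ coeffℤ q i
coeffℤ-+ℤₚ []      q       i       = sym (ℤP.+-identityˡ _)
coeffℤ-+ℤₚ (a ∷ p) []      i       = sym (ℤP.+-identityʳ _)
coeffℤ-+ℤₚ (a ∷ p) (b ∷ q) zero    = refl
coeffℤ-+ℤₚ (a ∷ p) (b ∷ q) (suc i) = coeffℤ-+ℤₚ p q i

coeffℤ-scaleℤₚ : ∀ c p i → coeffℤ (scaleℤₚ c p) i ≡ c ℤ.* coeffℤ p i
coeffℤ-scaleℤₚ c []      i       = sym (ℤP.*-zeroʳ c)
coeffℤ-scaleℤₚ c (a ∷ p) zero    = refl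
coeffℤ-scaleℤₚ c (a ∷ p) (suc i) = coeffℤ-scaleℤₚ c p i

coeffℤ-shiftℤₚ : ∀ j q i → coeffℤ (shiftℤₚ j q) (j ℕ.+ i) ≡ coeffℤ q i
coeffℤ-shiftℤₚ zero    q i = refl
coeffℤ-shiftℤₚ (suc j) q i = coeffℤ-shiftℤₚ j q i

coeffℤ-beyond : ∀ p {i} → length p ≤ i → coeffℤ p i ≡ 0ℤ
coeffℤ-beyond []      _         = refl
coeffℤ-beyond (a ∷ p) (s≤s len≤i) = coeffℤ-beyond p len≤i

length-shiftℤₚ : ∀ j q → length (shiftℤₚ j q) ≡ j ℕ.+ length q
length-shiftℤₚ zero    q = refl
length-shiftℤₚ (suc j) q = cong suc (length-shiftℤₚ j q)

evalℤ-+ℤₚ : ∀ p q x → evalℤ (p +ℤₚ q) x ≡ evalℤ p x ℤ.+ evalℤ q x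
evalℤ-+ℤₚ []      q       x = sym (ℤP.+-identityˡ _)
evalℤ-+ℤₚ (a ∷ p) []      x = sym (ℤP.+-identityʳ _)
evalℤ-+ℤₚ (a ∷ p) (b ∷ q) x =
  trans (cong (λ e → a ℤ.+ b ℤ.+ x ℤ.* e) (evalℤ-+ℤₚ p q x)) (interchange a b x _ _)
  where
  open ℤSolver.+-*-Solver
  interchange : ∀ a b x u v → a ℤ.+ b ℤ.+ x ℤ.* (u ℤ.+ v) ≡ (a ℤ.+ x ℤ.* u) ℤ.+ (b ℤ.+ x ℤ.* v)
  interchange = solve 5 (λ a b x u v → a :+ b :+ x :* (u :+ v) := (a :+ x :* u) :+ (b :+ x :* v)) refl

evalℤ-scaleℤₚ : ∀ c p x → evalℤ (scaleℤₚ c p) x ≡ c ℤ.* evalℤ p x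
evalℤ-scaleℤₚ c []      x = sym (ℤP.*-zeroʳ c)
evalℤ-scaleℤₚ c (a ∷ p) x =
  trans (cong (λ e → c ℤ.* a ℤ.+ x ℤ.* e) (evalℤ-scaleℤₚ c p x)) (factor c a x _)
  where
  open ℤSolver.+-*-Solver
  factor : ∀ c a x u → c ℤ.* a ℤ.+ x ℤ.* (c ℤ.* u) ≡ c ℤ.* (a ℤ.+ x ℤ.* u)
  factor = solve 4 (λ c a x u → c :* a :+ x :* (c :* u) := c :* (a :+ x :* u)) refl

coeff-toℚPoly : ∀ p i → coeff (toℚPoly p) i ≡ ι (coeffℤ p i)
coeff-toℚPoly []      i       = refl
coeff-toℚPoly (a ∷ p) zero    = refl
coeff-toℚPoly (a ∷ p) (suc i) = coeff-toℚPoly p i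

toℚPoly-shiftℤₚ : ∀ j q → toℚPoly (shiftℤₚ j q) ≡ shiftₚ j (toℚPoly q)
toℚPoly-shiftℤₚ zero    q = refl
toℚPoly-shiftℤₚ (suc j) q = cong (0ℚ ∷_) (toℚPoly-shiftℤₚ j q)

infixr 5 _∷ᵗ_
_∷ᵗ_ : ℤ → ℤPoly → ℤPoly
a        ∷ᵗ (b ∷ p) = a ∷ b ∷ p
(+ zero) ∷ᵗ []      = []
a        ∷ᵗ []      = a ∷ []

trim : ℤPoly → ℤPoly
trim []      = []
trim (a ∷ p) = a ∷ᵗ trim p

Trimmed : ℤPoly → Set
Trimmed p = ∀ L → (∀ i → L ≤ i → coeffℤ p i ≡ 0ℤ) → length p ≤ L

leading : ℤPoly → ℤ
leading []      = 0ℤ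
leading (a ∷ p) = coeffℤ (a ∷ p) (length p)

coeffℤ-∷ᵗ : ∀ a p i → coeffℤ (a ∷ᵗ p) i ≡ coeffℤ (a ∷ p) i
coeffℤ-∷ᵗ (+ zero)  []      zero    = refl
coeffℤ-∷ᵗ (+ zero)  []      (suc i) = refl
coeffℤ-∷ᵗ (+ suc n) []      i       = refl
coeffℤ-∷ᵗ -[1+ n ]  []      i       = refl
coeffℤ-∷ᵗ a         (b ∷ p) i       = refl

coeffℤ-trim : ∀ p i → coeffℤ (trim p) i ≡ coeffℤ p i
coeffℤ-trim []      i       = refl
coeffℤ-trim (a ∷ p) i       = trans (coeffℤ-∷ᵗ a (trim p) i) (tail-trim i)
  where
  tail-trim : ∀ i → coeffℤ (a ∷ trim p) i ≡ coeffℤ (a ∷ p) i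
  tail-trim zero    = refl
  tail-trim (suc i) = coeffℤ-trim p i

evalℤ-∷ᵗ : ∀ a p x → evalℤ (a ∷ᵗ p) x ≡ evalℤ (a ∷ p) x
evalℤ-∷ᵗ (+ zero)  []      x = sym (trans (ℤP.+-identityˡ _) (ℤP.*-zeroʳ x))
evalℤ-∷ᵗ (+ suc n) []      x = refl
evalℤ-∷ᵗ -[1+ n ]  []      x = refl
evalℤ-∷ᵗ a         (b ∷ p) x = refl

evalℤ-trim : ∀ p x → evalℤ (trim p) x ≡ evalℤ p x
evalℤ-trim []      x = refl
evalℤ-trim (a ∷ p) x =
  trans (evalℤ-∷ᵗ a (trim p) x) (cong (λ e → a ℤ.+ x ℤ.* e) (evalℤ-trim p x))

∷ᵗ-trimmed : ∀ a p → Trimmed p → Trimmed (a ∷ᵗ p)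
∷ᵗ-trimmed (+ zero)  []      _     L       _        = z≤n
∷ᵗ-trimmed (+ suc n) []      _     zero    vanishes with vanishes 0 z≤n
... | ()
∷ᵗ-trimmed (+ suc n) []      _     (suc L) _        = s≤s z≤n
∷ᵗ-trimmed -[1+ n ]  []      _     zero    vanishes with vanishes 0 z≤n
... | ()
∷ᵗ-trimmed -[1+ n ]  []      _     (suc L) _        = s≤s z≤n
∷ᵗ-trimmed a         (b ∷ p) tp    zero    vanishes with tp zero (λ i _ → vanishes (suc i) z≤n)
... | ()
∷ᵗ-trimmed a         (b ∷ p) tp    (suc L) vanishes =
  s≤s (tp L (λ i L≤i → vanishes (suc i) (s≤s L≤i)))

trim-trimmed : ∀ p → Trimmed (trim p)
trim-trimmed []      L _ = z≤n
trim-trimmed (a ∷ p)     = ∷ᵗ-trimmed a (trim p) (trim-trimmed p)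

trimmed⇒leading≢0 : ∀ b q → Trimmed (b ∷ q) → leading (b ∷ q) ≢ 0ℤ
trimmed⇒leading≢0 b q trimmed lead≡0 = ℕP.<-irrefl refl (trimmed (length q) vanishes)
  where
  vanishes : ∀ i → length q ≤ i → coeffℤ (b ∷ q) i ≡ 0ℤ
  vanishes i len≤i with ℕP.m≤n⇒m<n∨m≡n len≤i
  ... | inj₂ refl = lead≡0
  ... | inj₁ len<i = coeffℤ-beyond (b ∷ q) len<i

∣ₚ-trim : ∀ g p → g ∣ₚ toℚPoly (trim p) → g ∣ₚ toℚPoly p
∣ₚ-trim g p = ∣ₚ-respʳ g (toℚPoly (trim p)) (toℚPoly p) λ i →
  trans (coeff-toℚPoly (trim p) i) (trans (cong ι (coeffℤ-trim p i)) (sym (coeff-toℚPoly p i)))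

-- Pseudo-division and gcds inside an ideal

cancelLeading : ℤPoly → ℤPoly → ℤPoly
cancelLeading p q =
  scaleℤₚ (leading q) p +ℤₚ scaleℤₚ (ℤ.- leading p) (shiftℤₚ (length p ∸ length q) q)

eliminate : ℤPoly → ℤPoly → ℤPoly
eliminate p q = trim (cancelLeading p q)

coeffℤ-cancelLeading : ∀ p q i → coeffℤ (cancelLeading p q) i ≡
  leading q ℤ.* coeffℤ p i ℤ.+ (ℤ.- leading p) ℤ.* coeffℤ (shiftℤₚ (length p ∸ length q) q) i
coeffℤ-cancelLeading p q i = trans (coeffℤ-+ℤₚ (scaleℤₚ (leading q) p) (scaleℤₚ (ℤ.- leading p) xʲq) i)
  (cong₂ ℤ._+_ (coeffℤ-scaleℤₚ (leading q) p i) (coeffℤ-scaleℤₚ (ℤ.- leading p) xʲq i))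
  where xʲq = shiftℤₚ (length p ∸ length q) q

length-eliminate : ∀ a p b q → length q ≤ length p → length (eliminate (a ∷ p) (b ∷ q)) ≤ length p
length-eliminate a p b q q≤p = trim-trimmed R (length p) λ i p≤i →
  trans (coeffℤ-trim R i) (trans (coeffℤ-cancelLeading (a ∷ p) (b ∷ q) i) (vanishes i p≤i))
  where
  R = cancelLeading (a ∷ p) (b ∷ q)
  j = length p ∸ length q
  lp = leading (a ∷ p)
  lq = leading (b ∷ q)
  j+q≡p : j ℕ.+ length q ≡ length p
  j+q≡p = ℕP.m∸n+n≡m q≤p
  vanishes : ∀ i → length p ≤ i → lq ℤ.* coeffℤ (a ∷ p) i ℤ.+ (ℤ.- lp) ℤ.* coeffℤ (shiftℤₚ j (b ∷ q)) i ≡ 0ℤ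
  vanishes i p≤i with ℕP.m≤n⇒m<n∨m≡n p≤i
  ... | inj₂ refl = trans (cong (λ z → lq ℤ.* lp ℤ.+ (ℤ.- lp) ℤ.* z) shifted-leading) (cancel lq lp)
    where
    open ℤSolver.+-*-Solver
    cancel : ∀ x y → x ℤ.* y ℤ.+ (ℤ.- y) ℤ.* x ≡ 0ℤ
    cancel = solve 2 (λ x y → x :* y :+ (:- y) :* x := con 0ℤ) refl
    shifted-leading : coeffℤ (shiftℤₚ j (b ∷ q)) (length p) ≡ lq
    shifted-leading = trans (cong (coeffℤ (shiftℤₚ j (b ∷ q))) (sym j+q≡p)) (coeffℤ-shiftℤₚ j (b ∷ q) (length q))
  ... | inj₁ p<i = trans (cong₂ (λ u v → lq ℤ.* u ℤ.+ (ℤ.- lp) ℤ.* v)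
          (coeffℤ-beyond (a ∷ p) p<i) (coeffℤ-beyond (shiftℤₚ j (b ∷ q)) shift<i))
        (cong₂ ℤ._+_ (ℤP.*-zeroʳ lq) (ℤP.*-zeroʳ (ℤ.- lp)))
    where
    shift<i : length (shiftℤₚ j (b ∷ q)) ≤ i
    shift<i = subst (_≤ i) (sym (trans (length-shiftℤₚ j (b ∷ q))
      (trans (ℕP.+-suc j (length q)) (cong suc j+q≡p)))) p<i

toℚPoly-cancelLeading : ∀ p q → (lq≢0 : leading q ≢ 0ℤ) →
  let instance _ = ℚ.≢-nonZero (λ e → lq≢0 (ι-injective e)) in
  toℚPoly p ≈ₚ scaleₚ (ℚ.1/ ι (leading q))
    (toℚPoly (cancelLeading p q) +ₚ scaleₚ (ι (leading p)) (shiftₚ (length p ∸ length q) (toℚPoly q)))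
toℚPoly-cancelLeading p q lq≢0 i = sym (begin
    coeff (scaleₚ w (toℚPoly R +ₚ scaleₚ (ι lp) (shiftₚ j (toℚPoly q)))) i
  ≡⟨ coeff-scaleₚ w (toℚPoly R +ₚ scaleₚ (ι lp) (shiftₚ j (toℚPoly q))) i ⟩
    w ℚ.* coeff (toℚPoly R +ₚ scaleₚ (ι lp) (shiftₚ j (toℚPoly q))) i
  ≡⟨ cong (w ℚ.*_) (trans (coeff-+ₚ (toℚPoly R) _ i) (cong₂ ℚ._+_ (coeff-toℚPoly R i) (coeff-scaleₚ (ι lp) (shiftₚ j (toℚPoly q)) i))) ⟩
    w ℚ.* (ι (coeffℤ R i) ℚ.+ ι lp ℚ.* coeff (shiftₚ j (toℚPoly q)) i)
  ≡⟨ cong₂ (λ a b → w ℚ.* (ι a ℚ.+ ι lp ℚ.* b)) (coeffℤ-cancelLeading p q i) shifted ⟩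
    w ℚ.* (ι (lq ℤ.* P ℤ.+ (ℤ.- lp) ℤ.* S) ℚ.+ ι lp ℚ.* ι S)
  ≡⟨ cong (λ a → w ℚ.* (a ℚ.+ ι lp ℚ.* ι S)) (trans (ι-+ (lq ℤ.* P) ((ℤ.- lp) ℤ.* S)) (cong₂ ℚ._+_ (ι-* lq P) (ι-* (ℤ.- lp) S))) ⟩
    w ℚ.* ((ι lq ℚ.* ι P ℚ.+ ι (ℤ.- lp) ℚ.* ι S) ℚ.+ ι lp ℚ.* ι S)
  ≡⟨ regroup w (ι lq) (ι P) (ι (ℤ.- lp)) (ι lp) (ι S) ⟩
    (w ℚ.* ι lq) ℚ.* ι P ℚ.+ w ℚ.* ι S ℚ.* (ι (ℤ.- lp) ℚ.+ ι lp)
  ≡⟨ cong₂ (λ a b → a ℚ.* ι P ℚ.+ w ℚ.* ι S ℚ.* b) (ℚP.*-inverseˡ (ι lq))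
       (trans (sym (ι-+ (ℤ.- lp) lp)) (cong ι (ℤP.+-inverseˡ lp))) ⟩
    1ℚ ℚ.* ι P ℚ.+ w ℚ.* ι S ℚ.* 0ℚ
  ≡⟨ trans (cong₂ ℚ._+_ (ℚP.*-identityˡ (ι P)) (ℚP.*-zeroʳ (w ℚ.* ι S))) (ℚP.+-identityʳ (ι P)) ⟩
    ι P
  ≡⟨ coeff-toℚPoly p i ⟨
    coeff (toℚPoly p) i
  ∎)
  where
  open ≡-Reasoning
  open ℚSolver.+-*-Solver
  instance _ = ℚ.≢-nonZero (λ e → lq≢0 (ι-injective e))
  R = cancelLeading p q
  j = length p ∸ length q
  lp = leading p
  lq = leading q
  w = ℚ.1/ ι lq
  P = coeffℤ p i
  S = coeffℤ (shiftℤₚ j q) i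
  shifted : coeff (shiftₚ j (toℚPoly q)) i ≡ ι S
  shifted = trans (cong (λ z → coeff z i) (sym (toℚPoly-shiftℤₚ j q))) (coeff-toℚPoly (shiftℤₚ j q) i)
  regroup : ∀ w L P M N S → w ℚ.* ((L ℚ.* P ℚ.+ M ℚ.* S) ℚ.+ N ℚ.* S) ≡ (w ℚ.* L) ℚ.* P ℚ.+ w ℚ.* S ℚ.* (M ℚ.+ N)
  regroup = solve 6 (λ w L P M N S → w :* ((L :* P :+ M :* S) :+ N :* S) := (w :* L) :* P :+ w :* S :* (M :+ N)) refl

∣ₚ-eliminate : ∀ g p q → leading q ≢ 0ℤ →
  g ∣ₚ toℚPoly (eliminate p q) → g ∣ₚ toℚPoly q → g ∣ₚ toℚPoly p
∣ₚ-eliminate g p q lq≢0 g∣e g∣q = ∣ₚ-respʳ g (scaleₚ w sum) (toℚPoly p)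
  (λ i → sym (toℚPoly-cancelLeading p q lq≢0 i)) (∣ₚ-scaleₚ g sum w g∣sum)
  where
  instance _ = ℚ.≢-nonZero (λ e → lq≢0 (ι-injective e))
  w = ℚ.1/ ι (leading q)
  j = length p ∸ length q
  R = cancelLeading p q
  sum = toℚPoly R +ₚ scaleₚ (ι (leading p)) (shiftₚ j (toℚPoly q))
  g∣sum : g ∣ₚ sum
  g∣sum = ∣ₚ-+ₚ g (toℚPoly R) _ (∣ₚ-trim g R g∣e)
    (∣ₚ-scaleₚ g (shiftₚ j (toℚPoly q)) (ι (leading p)) (∣ₚ-shiftₚ g (toℚPoly q) j g∣q))

-- Divisibility in ℚ[x] expressed through divisors, which avoids needing associativity of *ₚ.
_∣ᵈ_ : ℤPoly → ℤPoly → Set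
G ∣ᵈ p = ∀ g → g ∣ₚ toℚPoly G → g ∣ₚ toℚPoly p

∣ᵈ-[] : ∀ G → G ∣ᵈ []
∣ᵈ-[] G g _ = ∣ₚ-[] g

∣ᵈ-refl : ∀ G → G ∣ᵈ G
∣ᵈ-refl G g g∣G = g∣G

∣ᵈ-trim : ∀ G p → G ∣ᵈ trim p → G ∣ᵈ p
∣ᵈ-trim G p G∣p g g∣G = ∣ₚ-trim g p (G∣p g g∣G)

∣ᵈ-eliminate : ∀ G p q → leading q ≢ 0ℤ → G ∣ᵈ eliminate p q → G ∣ᵈ q → G ∣ᵈ p
∣ᵈ-eliminate G p q lq≢0 G∣e G∣q g g∣G = ∣ₚ-eliminate g p q lq≢0 (G∣e g g∣G) (G∣q g g∣G)

-- trim-closed only matters for the list representation: any predicate on the polynomial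
-- function has it.
record IsIdeal (P : ℤPoly → Set) : Set where
  field
    []-closed    : P []
    +-closed     : ∀ {p q} → P p → P q → P (p +ℤₚ q)
    scale-closed : ∀ c {p} → P p → P (scaleℤₚ c p)
    x*-closed    : ∀ {p} → P p → P (0ℤ ∷ p)
    trim-closed  : ∀ {p} → P p → P (trim p)

  shift-closed : ∀ j {p} → P p → P (shiftℤₚ j p)
  shift-closed zero    Pp = Pp
  shift-closed (suc j) Pp = x*-closed (shift-closed j Pp)

  eliminate-closed : ∀ {p q} → P p → P q → P (eliminate p q)
  eliminate-closed {p} {q} Pp Pq = trim-closed (+-closed (scale-closed (leading q) Pp)
    (scale-closed (ℤ.- leading p) (shift-closed (length p ∸ length q) Pq)))

module _ {P : ℤPoly → Set} (ideal : IsIdeal P) where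
  open IsIdeal ideal

  ideal-gcd₂ : ∀ n p q → Trimmed p → Trimmed q → length p ℕ.+ length q ≤ n → P p → P q →
    Σ ℤPoly λ G → P G × G ∣ᵈ p × G ∣ᵈ q
  ideal-gcd₂ n p [] _ _ _ Pp _ = p , Pp , ∣ᵈ-refl p , ∣ᵈ-[] p
  ideal-gcd₂ n [] q _ _ _ _ Pq = q , Pq , ∣ᵈ-[] q , ∣ᵈ-refl q
  ideal-gcd₂ (suc n) (a ∷ p) (b ∷ q) tp tq (s≤s p+q<n) Pp Pq with length q ℕP.≤? length p
  ... | yes q≤p =
    let G , PG , G∣r , G∣q = ideal-gcd₂ n (eliminate (a ∷ p) (b ∷ q)) (b ∷ q)
          (trim-trimmed (cancelLeading (a ∷ p) (b ∷ q))) tq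
          (ℕP.≤-trans (ℕP.+-monoˡ-≤ (suc (length q)) (length-eliminate a p b q q≤p)) p+q<n)
          (eliminate-closed Pp Pq) Pq
    in G , PG , ∣ᵈ-eliminate G (a ∷ p) (b ∷ q) (trimmed⇒leading≢0 b q tq) G∣r G∣q , G∣q
  ... | no q≰p =
    let G , PG , G∣p , G∣r = ideal-gcd₂ n (a ∷ p) (eliminate (b ∷ q) (a ∷ p))
          tp (trim-trimmed (cancelLeading (b ∷ q) (a ∷ p)))
          (ℕP.≤-trans (ℕP.+-monoʳ-≤ (suc (length p)) (length-eliminate b q a p (ℕP.<⇒≤ (ℕP.≰⇒> q≰p))))
            (subst (_≤ n) (ℕP.+-suc (length p) (length q)) p+q<n))
          Pp (eliminate-closed Pq Pp)
    in G , PG , G∣p , ∣ᵈ-eliminate G (b ∷ q) (a ∷ p) (trimmed⇒leading≢0 a p tp) G∣r G∣p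

  ideal-gcd : ∀ s (f : Vector ℤPoly s) → (∀ i → P (f i)) → Σ ℤPoly λ G → P G × ∀ i → G ∣ᵈ f i
  ideal-gcd zero    f Pf = [] , []-closed , λ ()
  ideal-gcd (suc s) f Pf =
    let G′ , PG′ , G′∣tail = ideal-gcd s (tail f) (λ i → Pf (Fin.suc i))
        G , PG , G∣head , G∣G′ = ideal-gcd₂ _ (trim (head f)) (trim G′) (trim-trimmed (head f)) (trim-trimmed G′)
          ℕP.≤-refl (trim-closed (Pf Fin.zero)) (trim-closed PG′)
        G∣f : ∀ i → G ∣ᵈ f i
        G∣f = λ { Fin.zero → ∣ᵈ-trim G (head f) G∣head
                ; (Fin.suc i) g g∣G → G′∣tail i g (∣ᵈ-trim G G′ G∣G′ g g∣G) }
    in G , PG , G∣f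

evalℤ-zero : ∀ G x → (∀ i → coeffℤ G i ≡ 0ℤ) → evalℤ G x ≡ 0ℤ
evalℤ-zero []      x _   = refl
evalℤ-zero (a ∷ G) x G≡0 = trans (cong₂ (λ u v → u ℤ.+ x ℤ.* v) (G≡0 zero) (evalℤ-zero G x (λ i → G≡0 (suc i))))
  (trans (ℤP.+-identityˡ _) (ℤP.*-zeroʳ x))

evalℤ-constant : ∀ G x → (∀ i → coeffℤ G (suc i) ≡ 0ℤ) → evalℤ G x ≡ coeffℤ G zero
evalℤ-constant []      x _   = refl
evalℤ-constant (a ∷ G) x G≡0 = trans (cong (λ v → a ℤ.+ x ℤ.* v) (evalℤ-zero G x G≡0))
  (trans (cong (λ v → a ℤ.+ v) (ℤP.*-zeroʳ x)) (ℤP.+-identityʳ a))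

unit⇒constant : ∀ G → IsUnitₚ (toℚPoly G) → coeffℤ G zero ≢ 0ℤ × (∀ x → evalℤ G x ≡ coeffℤ G zero)
unit⇒constant G (c , c≢0 , G≈c) = c₀≢0 , λ x → evalℤ-constant G x cᵢ₊₁≡0
  where
  c₀≢0 : coeffℤ G zero ≢ 0ℤ
  c₀≢0 c₀≡0 = c≢0 (trans (sym (G≈c zero)) (trans (coeff-toℚPoly G zero) (cong ι c₀≡0)))
  cᵢ₊₁≡0 : ∀ i → coeffℤ G (suc i) ≡ 0ℤ
  cᵢ₊₁≡0 i = ι-injective (trans (sym (coeff-toℚPoly G (suc i))) (G≈c (suc i)))

-- Elementary number theory

∣gcd*gcd : ∀ {c} a b → c ∣ a * b → c ∣ gcd c a * gcd c b
∣gcd*gcd {c} a b c∣ab = subst (c ∣_) (sym (c*gcd[m,n]≡gcd[cm,cn] (gcd c a) c b))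
  (gcd-greatest (n∣m*n (gcd c a)) c∣gcd[c,a]*b)
  where
  c∣gcd[c,a]*b : c ∣ gcd c a * b
  c∣gcd[c,a]*b = subst (c ∣_) (trans (sym (c*gcd[m,n]≡gcd[cm,cn] b c a)) (ℕP.*-comm b (gcd c a)))
    (gcd-greatest (n∣m*n b) (subst (c ∣_) (ℕP.*-comm a b) c∣ab))

coprime⇒*∣ : ∀ {a b n} → ℕC.Coprime a b → a ∣ n → b ∣ n → a * b ∣ n
coprime⇒*∣ {a} {b} cop a∣n b∣n = subst (_∣ _) lcm≡a*b (lcm-least a∣n b∣n)
  where
  lcm≡a*b : lcm a b ≡ a * b
  lcm≡a*b = trans (sym (ℕP.*-identityˡ (lcm a b)))
    (trans (cong (_* lcm a b) (sym (ℕC.coprime⇒gcd≡1 cop))) (gcd*lcm a b))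

-- c divides gcd c a * gcd c b, a product of coprime divisors of n.
coprime-∣-split : ∀ {a b c n} → ℕC.Coprime a b → c ∣ a * b → gcd c a ∣ n → gcd c b ∣ n → c ∣ n
coprime-∣-split {a} {b} {c} cop c∣ab ga∣n gb∣n = ∣-trans (∣gcd*gcd a b c∣ab) (coprime⇒*∣ gcds-coprime ga∣n gb∣n)
  where
  gcds-coprime : ℕC.Coprime (gcd c a) (gcd c b)
  gcds-coprime (d∣ga , d∣gb) = cop (∣-trans d∣ga (gcd[m,n]∣n c a) , ∣-trans d∣gb (gcd[m,n]∣n c b))

prime∤⇒coprime : ∀ {p m} → Prime p → ¬ p ∣ m → ℕC.Coprime p m
prime∤⇒coprime pp p∤m (d∣p , d∣m) with prime⇒irreducible pp d∣p
... | inj₁ d≡1    = d≡1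
... | inj₂ refl   = ⊥-elim (p∤m d∣m)

coprime-*ˡ : ∀ {a c b} → ℕC.Coprime a b → ℕC.Coprime c b → ℕC.Coprime (a * c) b
coprime-*ˡ cop-ab cop-cb (d∣ac , d∣b) =
  cop-cb (ℕC.coprime-divisor (λ (e∣d , e∣a) → cop-ab (e∣a , ∣-trans e∣d d∣b)) d∣ac , d∣b)

coprime-^ˡ : ∀ {a b} e → ℕC.Coprime a b → ℕC.Coprime (a ^ e) b
coprime-^ˡ zero    _   (d∣1 , _) = ∣1⇒≡1 d∣1
coprime-^ˡ (suc e) cop = coprime-*ˡ cop (coprime-^ˡ e cop)

p∤∧∣p^e⇒≡1 : ∀ {p z} → Prime p → ¬ p ∣ z → ∀ e → z ∣ p ^ e → z ≡ 1
p∤∧∣p^e⇒≡1 pp p∤z e z∣ = ℕC.sym (coprime-^ˡ e (prime∤⇒coprime pp p∤z)) (∣-refl , z∣)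

∣p^e-total : ∀ {p} → Prime p → ∀ e {x y} → x ∣ p ^ e → y ∣ p ^ e → (x ∣ y) ⊎ (y ∣ x)
∣p^e-total pp zero    {x} {y} x∣1 _ = inj₁ (subst (_∣ y) (sym (∣1⇒≡1 x∣1)) (1∣ y))
∣p^e-total {p} pp (suc e) {x} {y} x∣ y∣ with p ∣? x | p ∣? y
... | no p∤x | _      = inj₁ (subst (_∣ y) (sym (p∤∧∣p^e⇒≡1 pp p∤x (suc e) x∣)) (1∣ y))
... | yes _  | no p∤y = inj₂ (subst (_∣ x) (sym (p∤∧∣p^e⇒≡1 pp p∤y (suc e) y∣)) (1∣ x))
... | yes (divides x′ refl) | yes (divides y′ refl) =
  Sum.map (*-monoˡ-∣ p) (*-monoˡ-∣ p) (∣p^e-total pp e (cancel x′ x∣) (cancel y′ y∣))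
  where
  instance _ = prime⇒nonZero pp
  cancel : ∀ z → z * p ∣ p * p ^ e → z ∣ p ^ e
  cancel z h = *-cancelʳ-∣ p (subst (z * p ∣_) (ℕP.*-comm p (p ^ e)) h)

primePart : ∀ {p} → Prime p → ∀ M → .{{NonZero M}} → Σ ℕ λ e → Σ ℕ λ M′ → M ≡ p ^ e * M′ × ¬ p ∣ M′
primePart {p} pp = <-rec Split split
  where
  Split : ℕ → Set
  Split M = .{{NonZero M}} → Σ ℕ λ e → Σ ℕ λ M′ → M ≡ p ^ e * M′ × ¬ p ∣ M′
  split : ∀ M → WfRec _<_ Split M → Split M
  split M rec with p ∣? M
  ... | no p∤M = 0 , M , sym (ℕP.*-identityˡ M) , p∤M
  ... | yes (divides q refl) =
    let e , M′ , q≡p^e*M′ , p∤M′ = rec q<q*p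
    in suc e , M′ , trans (cong (_* p) q≡p^e*M′) (trans (ℕP.*-comm (p ^ e * M′) p) (sym (ℕP.*-assoc p (p ^ e) M′))) , p∤M′
    where
    instance
      _ = prime⇒nonTrivial pp
      _ = ℕP.m*n≢0⇒m≢0 q
    q<q*p : q < q * p
    q<q*p = ℕP.m<m*n q p (ℕ.nonTrivial⇒n>1 p)

primeDivisor : ∀ M → .{{NonZero M}} → M ≢ 1 → Σ ℕ λ p → Prime p × p ∣ M
primeDivisor M M≢1 with factorise M
... | record { factors = [] ; isFactorisation = M≡1 } = ⊥-elim (M≢1 M≡1)
... | record { factors = p ∷ ps ; isFactorisation = M≡p*ps ; factorsPrime = pp ∷ _ } =
  p , pp , subst (p ∣_) (sym M≡p*ps) (m∣m*n (product ps))

coprime-induction : (Q : ℕ → Set) → Q 1 → (∀ {p} e → Prime p → Q (p ^ e)) →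
  (∀ {a b} → ℕC.Coprime a b → Q a → Q b → Q (a * b)) → ∀ M → .{{NonZero M}} → Q M
coprime-induction Q Q1 Qpow Q* = <-rec (λ M → .{{NonZero M}} → Q M) step
  where
  step : ∀ M → WfRec _<_ (λ M → .{{NonZero M}} → Q M) M → .{{NonZero M}} → Q M
  step M rec with M ℕP.≟ 1
  ... | yes refl = Q1
  ... | no M≢1 with primeDivisor M M≢1
  ...   | p , pp , p∣M with primePart pp M
  ...     | zero , M′ , M≡M′ , p∤M′ = ⊥-elim (p∤M′ (subst (p ∣_) (trans M≡M′ (ℕP.*-identityˡ M′)) p∣M))
  ...     | suc e , M′ , M≡p^[1+e]*M′ , p∤M′ = subst Q (sym M≡p^[1+e]*M′)
    (Q* (coprime-^ˡ (suc e) (prime∤⇒coprime pp p∤M′)) (Qpow (suc e) pp) (rec M′<M))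
    where
    instance
      nzM′ : NonZero M′
      nzM′ = ℕ.≢-nonZero λ M′≡0 → ℕ.≢-nonZero⁻¹ M (trans M≡p^[1+e]*M′ (trans (cong (p ^ suc e *_) M′≡0) (ℕP.*-zeroʳ (p ^ suc e))))
      _ = prime⇒nonTrivial pp
    M′<M : M′ < M
    M′<M = subst (M′ <_) (trans (ℕP.*-comm M′ (p ^ suc e)) (sym M≡p^[1+e]*M′))
      (ℕP.m<m*n M′ (p ^ suc e) (ℕP.^-monoʳ-< p (ℕ.nonTrivial⇒n>1 p) {0} {suc e} z<s))

i≤+∣i∣ : ∀ i → i ℤ.≤ + ∣ i ∣
i≤+∣i∣ (+ n)    = ℤP.≤-refl
i≤+∣i∣ -[1+ n ] = ℤ.-≤+

-- Congruences and the Chinese remainder theorem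

infix 4 _≡_mod_
record _≡_mod_ (x y : ℤ) (M : ℕ) : Set where
  constructor congruent
  field divides-difference : (+ M) ℤS.∣ (x ℤ.- y)

≡-mod-refl : ∀ {M} x → x ≡ x mod M
≡-mod-refl x = congruent (ℤS.divides 0ℤ (ℤP.+-inverseʳ x))

≡-mod-sym : ∀ {M x y} → x ≡ y mod M → y ≡ x mod M
≡-mod-sym {M} {x} {y} (congruent M∣x-y) = congruent (subst ((+ M) ℤS.∣_) (negate x y) (ℤS.∣m⇒∣-m M∣x-y))
  where
  open ℤSolver.+-*-Solver
  negate : ∀ x y → ℤ.- (x ℤ.- y) ≡ y ℤ.- x
  negate = solve 2 (λ x y → :- (x :- y) := y :- x) refl

evalℤ-cong : ∀ {M x y} p → x ≡ y mod M → evalℤ p x ≡ evalℤ p y mod M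
evalℤ-cong         []      _   = congruent (ℤS.divides 0ℤ refl)
evalℤ-cong {M} {x} {y} (a ∷ p) x≡y@(congruent M∣x-y) = congruent (subst ((+ M) ℤS.∣_)
  (sym (difference a x y (evalℤ p x) (evalℤ p y)))
  (ℤS.∣m∣n⇒∣m+n (ℤS.∣m⇒∣m*n (evalℤ p x) M∣x-y) (ℤS.∣n⇒∣m*n y (_≡_mod_.divides-difference (evalℤ-cong p x≡y)))))
  where
  open ℤSolver.+-*-Solver
  difference : ∀ a x y u v → (a ℤ.+ x ℤ.* u) ℤ.- (a ℤ.+ y ℤ.* v) ≡ (x ℤ.- y) ℤ.* u ℤ.+ y ℤ.* (u ℤ.- v)
  difference = solve 5 (λ a x y u v → (a :+ x :* u) :- (a :+ y :* v) := (x :- y) :* u :+ y :* (u :- v)) refl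

-- From Bézout, e ≡ 0 (mod a) and e ≡ 1 (mod b); then z = x (1 − e) + y e.
crt : ∀ {a b} → ℕC.Coprime a b → ∀ x y → Σ ℤ λ z → z ≡ x mod a × z ≡ y mod b
crt {a} {b} cop x y with idempotent (ℕC.coprime-Bézout cop)
  where
  idempotent : Bézout.Identity 1 a b → Σ ℤ λ e → (+ a) ℤS.∣ e × (+ b) ℤS.∣ (e ℤ.- + 1)
  idempotent (Bézout.+- u v 1+vb≡ua) = + (u * a) , ℤS.divides (+ u) (ℤP.pos-* u a) ,
    ℤS.divides (+ v) (trans (cong (λ z → + z ℤ.- + 1) (sym 1+vb≡ua))
      (trans (cong (ℤ._- + 1) (ℤP.pos-+ 1 (v * b))) (trans (cancel (+ (v * b))) (ℤP.pos-* v b))))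
    where
    open ℤSolver.+-*-Solver
    cancel : ∀ z → (+ 1 ℤ.+ z) ℤ.- + 1 ≡ z
    cancel = solve 1 (λ z → (con (+ 1) :+ z) :- con (+ 1) := z) refl
  idempotent (Bézout.-+ u v 1+ua≡vb) = ℤ.- + (u * a) ,
    subst ((+ a) ℤS.∣_) (cong ℤ.-_ (sym (ℤP.pos-* u a))) (ℤS.∣m⇒∣-m (ℤS.∣n⇒∣m*n (+ u) ℤS.∣-refl)) ,
    subst ((+ b) ℤS.∣_) e-1≡-vb (ℤS.∣m⇒∣-m (ℤS.divides (+ v) (ℤP.pos-* v b)))
    where
    open ℤSolver.+-*-Solver
    negate : ∀ z → ℤ.- (+ 1 ℤ.+ z) ≡ ℤ.- z ℤ.- + 1
    negate = solve 1 (λ z → :- (con (+ 1) :+ z) := :- z :- con (+ 1)) refl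
    e-1≡-vb : ℤ.- + (v * b) ≡ ℤ.- + (u * a) ℤ.- + 1
    e-1≡-vb = trans (cong (λ z → ℤ.- + z) (sym 1+ua≡vb)) (trans (cong ℤ.-_ (ℤP.pos-+ 1 (u * a))) (negate (+ (u * a))))
... | e , a∣e , b∣e-1 = x ℤ.* (+ 1 ℤ.- e) ℤ.+ y ℤ.* e ,
  congruent (subst ((+ a) ℤS.∣_) (sym (at-x x y e)) (ℤS.∣n⇒∣m*n (y ℤ.- x) a∣e)) ,
  congruent (subst ((+ b) ℤS.∣_) (sym (at-y x y e)) (ℤS.∣n⇒∣m*n (y ℤ.- x) b∣e-1))
  where
  open ℤSolver.+-*-Solver
  at-x : ∀ x y e → (x ℤ.* (+ 1 ℤ.- e) ℤ.+ y ℤ.* e) ℤ.- x ≡ (y ℤ.- x) ℤ.* e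
  at-x = solve 3 (λ x y e → (x :* (con (+ 1) :- e) :+ y :* e) :- x := (y :- x) :* e) refl
  at-y : ∀ x y e → (x ℤ.* (+ 1 ℤ.- e) ℤ.+ y ℤ.* e) ℤ.- y ≡ (y ℤ.- x) ℤ.* (e ℤ.- + 1)
  at-y = solve 3 (λ x y e → (x :* (con (+ 1) :- e) :+ y :* e) :- y := (y :- x) :* (e :- con (+ 1))) refl

residue : ∀ M → .{{NonZero M}} → ∀ x → Σ ℕ λ k → k < M × + k ≡ x mod M
residue M x = x ℤDM.%ℕ M , ℤDM.n%ℕd<d x M , ≡-mod-sym (congruent (ℤS.divides (x ℤDM./ℕ M) x-k≡q*M))
  where
  open ℤSolver.+-*-Solver
  cancel : ∀ k q → (k ℤ.+ q) ℤ.- k ≡ q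
  cancel = solve 2 (λ k q → (k :+ q) :- k := q) refl
  x-k≡q*M : x ℤ.- + (x ℤDM.%ℕ M) ≡ (x ℤDM./ℕ M) ℤ.* + M
  x-k≡q*M = trans (cong (ℤ._- + (x ℤDM.%ℕ M)) (ℤDM.a≡a%ℕn+[a/ℕn]*n x M)) (cancel (+ (x ℤDM.%ℕ M)) _)

-- Stated for an abstract family of preorders so that it applies to ⊑ and to its converse.
module LeastElement
  (_≼⟨_⟩_ : ℤ → ℕ → ℤ → Set)
  (≼-refl : ∀ {M} x → x ≼⟨ M ⟩ x)
  (≼-trans : ∀ {M x y z} → x ≼⟨ M ⟩ y → y ≼⟨ M ⟩ z → x ≼⟨ M ⟩ z)
  (≼-resp : ∀ {M x x′ y y′} → x ≡ x′ mod M → y ≡ y′ mod M → x ≼⟨ M ⟩ y → x′ ≼⟨ M ⟩ y′)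
  (≼-one : ∀ x y → x ≼⟨ 1 ⟩ y)
  (≼-total : ∀ {p} e → Prime p → ∀ x y → x ≼⟨ p ^ e ⟩ y ⊎ y ≼⟨ p ^ e ⟩ x)
  (≼-glue : ∀ {a b x y} → ℕC.Coprime a b → x ≼⟨ a ⟩ y → x ≼⟨ b ⟩ y → x ≼⟨ a * b ⟩ y)
  where

  LowerBound₂ : ℕ → Set
  LowerBound₂ M = ∀ x y → Σ ℤ λ z → z ≼⟨ M ⟩ x × z ≼⟨ M ⟩ y

  lowerBound₂ : ∀ M → .{{NonZero M}} → LowerBound₂ M
  lowerBound₂ = coprime-induction LowerBound₂ (λ x y → x , ≼-refl x , ≼-one x y) power glue
    where
    power : ∀ {p} e → Prime p → LowerBound₂ (p ^ e)
    power e pp x y with ≼-total e pp x y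
    ... | inj₁ x≼y = x , ≼-refl x , x≼y
    ... | inj₂ y≼x = y , y≼x , ≼-refl y
    glue : ∀ {a b} → ℕC.Coprime a b → LowerBound₂ a → LowerBound₂ b → LowerBound₂ (a * b)
    glue cop bound-a bound-b x y =
      let z₁ , z₁≼x , z₁≼y = bound-a x y
          z₂ , z₂≼x , z₂≼y = bound-b x y
          z , z≡z₁ , z≡z₂ = crt cop z₁ z₂
      in z , ≼-glue cop (move z≡z₁ z₁≼x) (move z≡z₂ z₂≼x) , ≼-glue cop (move z≡z₁ z₁≼y) (move z≡z₂ z₂≼y)
      where
      move : ∀ {M z z′ w} → z′ ≡ z mod M → z ≼⟨ M ⟩ w → z′ ≼⟨ M ⟩ w
      move {w = w} z′≡z = ≼-resp (≡-mod-sym z′≡z) (≡-mod-refl w)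

  lowerBound-residues : ∀ M → .{{NonZero M}} → ∀ j → Σ ℤ λ z → ∀ k → k < j → z ≼⟨ M ⟩ (+ k)
  lowerBound-residues M zero    = 0ℤ , λ k ()
  lowerBound-residues M (suc j) =
    let z , z≼[<j] = lowerBound-residues M j
        z′ , z′≼z , z′≼j = lowerBound₂ M z (+ j)
        below : ∀ k → k < j ⊎ k ≡ j → z′ ≼⟨ M ⟩ (+ k)
        below = λ { k (inj₁ k<j) → ≼-trans z′≼z (z≼[<j] k k<j) ; k (inj₂ refl) → z′≼j }
    in z′ , λ k k<1+j → below k (ℕP.m<1+n⇒m<n∨m≡n k<1+j)

  least : ∀ M → .{{NonZero M}} → Σ ℤ λ z → ∀ x → z ≼⟨ M ⟩ x
  least M =
    let z , z≼residues = lowerBound-residues M M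
    in z , λ x → let k , k<M , k≡x = residue M x in ≼-resp (≡-mod-refl z) k≡x (z≼residues k k<M)

-- The values dₙ

gcdᵥ : ∀ {s} → Vector ℤ s → ℕ
gcdᵥ = foldr (λ a b → gcd ∣ a ∣ b) 0

gcdᵥ-∣ : ∀ {s} (v : Vector ℤ s) i → gcdᵥ v ∣ ∣ v i ∣
gcdᵥ-∣ v Fin.zero    = gcd[m,n]∣m ∣ v Fin.zero ∣ (gcdᵥ (tail v))
gcdᵥ-∣ v (Fin.suc i) = ∣-trans (gcd[m,n]∣n ∣ v Fin.zero ∣ (gcdᵥ (tail v))) (gcdᵥ-∣ (tail v) i)

gcdᵥ-greatest : ∀ {s c} (v : Vector ℤ s) → (∀ i → c ∣ ∣ v i ∣) → c ∣ gcdᵥ v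
gcdᵥ-greatest {zero}  v _     = _ ∣0
gcdᵥ-greatest {suc s} v c∣v·  = gcd-greatest (c∣v· Fin.zero) (gcdᵥ-greatest (tail v) (λ i → c∣v· (Fin.suc i)))

module _ {s} (f : Vector ℤPoly s) where

  dₙ-∣ : ∀ x i → dₙ f x ∣ ∣ evalℤ (f i) x ∣
  dₙ-∣ x = gcdᵥ-∣ (λ i → evalℤ (f i) x)

  dₙ-greatest : ∀ {c} x → (∀ i → c ∣ ∣ evalℤ (f i) x ∣) → c ∣ dₙ f x
  dₙ-greatest x = gcdᵥ-greatest (λ i → evalℤ (f i) x)

  dₙ-periodic : ∀ {c M x y} → c ∣ M → x ≡ y mod M → c ∣ dₙ f x → c ∣ dₙ f y
  dₙ-periodic {c} {M} {x} {y} c∣M x≡y c∣dx = dₙ-greatest y λ i →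
    ℤS.∣⇒∣ᵤ (subst ((+ c) ℤS.∣_) (cancel (evalℤ (f i) x) (evalℤ (f i) y))
      (ℤS.∣m∣n⇒∣m-n (ℤS.∣ᵤ⇒∣ {+ c} {evalℤ (f i) x} (∣-trans c∣dx (dₙ-∣ x i)))
        (ℤS.∣-trans (ℤS.∣ᵤ⇒∣ c∣M) (_≡_mod_.divides-difference (evalℤ-cong (f i) x≡y)))))
    where
    open ℤSolver.+-*-Solver
    cancel : ∀ a b → a ℤ.- (a ℤ.- b) ≡ b
    cancel = solve 2 (λ a b → a :- (a :- b) := b) refl

  DividesValues : ℤPoly → Set
  DividesValues q = ∀ x → (+ dₙ f x) ℤS.∣ evalℤ q x

  dividesValues-ideal : IsIdeal DividesValues
  dividesValues-ideal = record
    { []-closed    = λ x → ℤS.divides 0ℤ refl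
    ; +-closed     = λ {p} {q} d∣p d∣q x → subst ((+ dₙ f x) ℤS.∣_) (sym (evalℤ-+ℤₚ p q x)) (ℤS.∣m∣n⇒∣m+n (d∣p x) (d∣q x))
    ; scale-closed = λ c {p} d∣p x → subst ((+ dₙ f x) ℤS.∣_) (sym (evalℤ-scaleℤₚ c p x)) (ℤS.∣n⇒∣m*n c (d∣p x))
    ; x*-closed    = λ {p} d∣p x → subst ((+ dₙ f x) ℤS.∣_) (sym (ℤP.+-identityˡ _)) (ℤS.∣n⇒∣m*n x (d∣p x))
    ; trim-closed  = λ {p} d∣p x → subst ((+ dₙ f x) ℤS.∣_) (sym (evalℤ-trim p x)) (d∣p x)
    }

  dₙ-bounded : Coprime f → Σ ℕ λ R → R ≢ 0 × ∀ x → dₙ f x ∣ R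
  dₙ-bounded coprime =
    let G , d∣G , G∣f = ideal-gcd dividesValues-ideal s f λ i x → ℤS.∣ᵤ⇒∣ {+ dₙ f x} {evalℤ (f i) x} (dₙ-∣ x i)
        c≢0 , G≡c = unit⇒constant G (coprime (toℚPoly G) λ i → G∣f i (toℚPoly G) (∣ₚ-refl (toℚPoly G)))
    in ∣ coeffℤ G zero ∣ , (λ ∣c∣≡0 → c≢0 (ℤP.∣i∣≡0⇒i≡0 ∣c∣≡0)) ,
       λ x → subst (λ z → dₙ f x ∣ ∣ z ∣) (G≡c x) (ℤS.∣⇒∣ᵤ {+ dₙ f x} {evalℤ G x} (d∣G x))

  -- x ⊑⟨ M ⟩ y says gcd (dₓ, M) ∣ d_y.
  _⊑⟨_⟩_ : ℤ → ℕ → ℤ → Set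
  x ⊑⟨ M ⟩ y = ∀ {c} → c ∣ M → c ∣ dₙ f x → c ∣ dₙ f y

  ⊑-refl : ∀ {M} x → x ⊑⟨ M ⟩ x
  ⊑-refl x _ c∣dx = c∣dx

  ⊑-trans : ∀ {M x y z} → x ⊑⟨ M ⟩ y → y ⊑⟨ M ⟩ z → x ⊑⟨ M ⟩ z
  ⊑-trans x⊑y y⊑z c∣M c∣dx = y⊑z c∣M (x⊑y c∣M c∣dx)

  ⊑-resp : ∀ {M x x′ y y′} → x ≡ x′ mod M → y ≡ y′ mod M → x ⊑⟨ M ⟩ y → x′ ⊑⟨ M ⟩ y′
  ⊑-resp x≡x′ y≡y′ x⊑y c∣M c∣dx′ = dₙ-periodic c∣M y≡y′ (x⊑y c∣M (dₙ-periodic c∣M (≡-mod-sym x≡x′) c∣dx′))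

  ⊑-one : ∀ x y → x ⊑⟨ 1 ⟩ y
  ⊑-one x y c∣1 _ = subst (_∣ dₙ f y) (sym (∣1⇒≡1 c∣1)) (1∣ dₙ f y)

  ⊑-total : ∀ {p} e → Prime p → ∀ x y → x ⊑⟨ p ^ e ⟩ y ⊎ y ⊑⟨ p ^ e ⟩ x
  ⊑-total {p} e pp x y = Sum.map (through x y) (through y x)
    (∣p^e-total pp e (gcd[m,n]∣n (dₙ f x) (p ^ e)) (gcd[m,n]∣n (dₙ f y) (p ^ e)))
    where
    through : ∀ x y → gcd (dₙ f x) (p ^ e) ∣ gcd (dₙ f y) (p ^ e) → x ⊑⟨ p ^ e ⟩ y
    through x y gx∣gy c∣pᵉ c∣dx = ∣-trans (gcd-greatest c∣dx c∣pᵉ) (∣-trans gx∣gy (gcd[m,n]∣m (dₙ f y) (p ^ e)))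

  ⊑-glue : ∀ {a b x y} → ℕC.Coprime a b → x ⊑⟨ a ⟩ y → x ⊑⟨ b ⟩ y → x ⊑⟨ a * b ⟩ y
  ⊑-glue {a} {b} cop x⊑y x⊑′y {c} c∣ab c∣dx = coprime-∣-split cop c∣ab
    (x⊑y  (gcd[m,n]∣n c a) (∣-trans (gcd[m,n]∣m c a) c∣dx))
    (x⊑′y (gcd[m,n]∣n c b) (∣-trans (gcd[m,n]∣m c b) c∣dx))

  module Least    = LeastElement _⊑⟨_⟩_ ⊑-refl ⊑-trans ⊑-resp ⊑-one ⊑-total ⊑-glue
  module Greatest = LeastElement (λ x M y → y ⊑⟨ M ⟩ x) ⊑-refl (flip ⊑-trans) (flip ⊑-resp)
    (flip ⊑-one) (λ e pp x y → Sum.swap (⊑-total e pp x y)) ⊑-glue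

  ∣dₙ⇒≤ : ∀ {R c y} → R ≢ 0 → (∀ x → dₙ f x ∣ R) → c ∣ dₙ f y → c ≤ dₙ f y
  ∣dₙ⇒≤ {R} {y = y} R≢0 d∣R = ∣⇒≤ {{ℕ.≢-nonZero λ d≡0 → R≢0 (0∣⇒≡0 (subst (_∣ R) d≡0 (d∣R y)))}}

  dₙ-minimum : ∀ R → R ≢ 0 → (∀ x → dₙ f x ∣ R) → Σ ℤ λ N → ∀ x → dₙ f N ∣ dₙ f x
  dₙ-minimum R R≢0 d∣R = let instance _ = ℕ.≢-nonZero R≢0 ; N , N⊑ = Least.least R
                         in N , λ x → N⊑ x (d∣R N) ∣-refl

  dₙ-maximum : ∀ R → R ≢ 0 → (∀ x → dₙ f x ∣ R) → Σ ℤ λ N → ∀ x → dₙ f x ∣ dₙ f N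
  dₙ-maximum R R≢0 d∣R = let instance _ = ℕ.≢-nonZero R≢0 ; N , ⊑N = Greatest.least R
                         in N , λ x → ⊑N x (d∣R x) ∣-refl

corollary3p5 : (s : ℕ) → 2 ≤ s → (f : Vector ℤPoly s) →
    (∀ (i : Fin s) → ¬ IsZeroₚ (toℚPoly (f i))) → Coprime f →
    (∃ λ (dstar : ℕ) → IsGCDof𝒟* f dstar × dstar ∈𝒟* f
      × (∀ (n : ℤ) → dstar ≤ dₙ f n)
      × (∀ (n : ℤ) (i : Fin s) → (+ dstar) ℤD.∣ evalℤ (f i) n)
      × (∀ (k : ℤ) → (∀ (n : ℤ) (i : Fin s) → k ℤD.∣ evalℤ (f i) n) → k ℤ.≤ + dstar))
    × (∃ λ (mstar : ℕ) → IsLCMof𝒟* f mstar × mstar ∈𝒟* f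
      × (∀ (n : ℤ) → dₙ f n ≤ mstar))
corollary3p5 s _ f _ coprime =
  let R , R≢0 , d∣R = dₙ-bounded f coprime
      N , N-min = dₙ-minimum f R R≢0 d∣R
      M , M-max = dₙ-maximum f R R≢0 d∣R
  in (dₙ f N , (N-min , λ _ c∣d → c∣d N) , (N , refl) , (λ x → ∣dₙ⇒≤ f R≢0 d∣R (N-min x))
     , (λ x i → ∣-trans (N-min x) (dₙ-∣ f x i))
     , λ k k∣f → ℤP.≤-trans (i≤+∣i∣ k) (ℤ.+≤+ (∣dₙ⇒≤ f R≢0 d∣R (dₙ-greatest f N (k∣f N)))))
   , (dₙ f M , (M-max , λ _ d∣c → d∣c M) , (M , refl) , λ x → ∣dₙ⇒≤ f R≢0 d∣R (M-max x))
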